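{- Let $T$ be a bipartite trigraph in the class $\mathcal F$. Then: (1) $T$ is either complete or has an even pair; (2) if $T$ is favorable, then $T$ has an even pair disjoint from its switchable component.
   Context: A trigraph $T$ consists of a finite set $V(T)$ and a map $\theta:\binom{V(T)}{2}\to\{ -1,0,1\}$. Distinct $u,v$ are strongly adjacent if $\theta(uv)=1$, strongly antiadjacent if $\theta(uv)=-1$, semiadjacent (a switchable pair) if $\theta(uv)=0$; adjacent if $\theta(uv)\in\{0,1\}$, antiadjacent if $\theta(uv)\in\{0,-1\}$. $N(v)$ is the set of vertices adjacent to $v$. $T|X$ is the restriction to $X$, $T\setminus X=T|(V(T)\setminus X)$. A clique is a set of pairwise adjacent vertices; $T$ is complete if $V(T)$ is a clique; a strongly stable set is a set of pairwise strongly antiadjacent vertices. $T$ is bipartite if $V(T)$ can be partitioned into two strongly stable sets. A path is a sequence $p_1,\dots,p_k$ of distinct vertices with $p_i,p_j$ adjacent when $|i-j|=1$ and antiadjacent when $|i-j|>1$; length $k-1$. A hole is a sequence $h_1,\dots,h_k$ ($k\ge5$) with cyclically consecutive vertices adjacent and other pairs antiadjacent; an antihole is an induced subtrigraph whose complement (adjacency $-\theta$) is a hole. $T$ is Berge if it has no odd hole and no odd antihole. An even pair is a strongly antiadjacent pair $\{u,v\}$ such that every path from $u$ to $v$ has even length. $\Sigma(T)$ is the graph on $V(T)$ whose edges are the switchable pairs; a switchable component is a component of $\Sigma(T)$ with at least two vertices. $\mathcal F$ is the class of Berge trigraphs with at most one switchable component, having at most two edges, such that if it has one edge $xy$ then $N(x)\cap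 N(y)=\emptyset$ (small), and if it has two edges $vx,vy$ then $v$ is strongly antiadjacent to all vertices outside $\{v,x,y\}$, $x,y$ are strongly antiadjacent and $N(x)\cap N(y)=\{v\}$ (light). $D$ denotes the vertex set of the switchable component ($\emptyset$ if none); a pair is disjoint from the switchable component if it does not meet $D$. $T\in\mathcal F$ is favorable if $|V(T)|\ge5$, $T$ has a strongly antiadjacent pair disjoint from $D$, and, if $D=\{x,y\}$ is small, at least one of $T\setminus(D\cup N(x))$, $T\setminus(D\cup N(y))$ is not a clique. -}

module Defs where

open import Data.Nat using (ℕ; zero; suc; _≤_; _<_)
open import Data.Nat.Divisibility using (_∣_)
import Data.Fin as Fin
open import Data.Fin using (Fin; toℕ; fromℕ)
open import Data.Bool using (Bool)
open import Data.Product using (Σ; ∃; _×_; _,_)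
open import Data.Sum using (_⊎_)
open import Data.Empty using (⊥)
open import Relation.Nullary using (¬_)
open import Relation.Binary.PropositionalEquality using (_≡_; _≢_)
open import Function.Definitions using (Injective)
import Data.Unit
import Relation.Binary.PropositionalEquality

-- Trigraphs: θ takes values -1 (anti), 0 (semi), 1 (strong)

data Val : Set where
  anti semi strong : Val

neg : Val → Val
neg anti   = strong
neg semi   = semi
neg strong = anti

-- A trigraph on vertex set Fin n; θ is only meaningful on distinct
-- pairs and is required to be symmetric (it is a map on unordered pairs).
record Trigraph : Set where
  field
    n    : ℕ
    θ    : Fin n → Fin n → Val
    symm : ∀ u v → θ u v ≡ θ v u

open Trigraph public

module _ (T : Trigraph) where

  V : Set
  V = Fin (n T)

  Adj : V → V → Set
  Adj u v = θ T u v ≡ strong ⊎ θ T u v ≡ semi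

  Antiadj : V → V → Set
  Antiadj u v = θ T u v ≡ semi ⊎ θ T u v ≡ anti

  StrongAnti : V → V → Set
  StrongAnti u v = θ T u v ≡ anti

  InN : V → V → Set
  InN v w = w ≢ v × Adj v w

  IsClique : (V → Set) → Set
  IsClique X = ∀ u v → X u → X v → u ≢ v → Adj u v

  Complete : Set
  Complete = ∀ u v → u ≢ v → Adj u v

  Bipartite : Set
  Bipartite = Σ (V → Bool) λ c → ∀ u v → u ≢ v → c u ≡ c v → StrongAnti u v

  IsPath : (m : ℕ) → (Fin (suc m) → V) → Set
  IsPath m p = Injective _≡_ _≡_ p
             × (∀ i j → toℕ j ≡ suc (toℕ i) → Adj (p i) (p j))
             × (∀ i j → suc (toℕ i) < toℕ j → Antiadj (p i) (p j))

  Even : ℕ → Set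
  Even m = 2 ∣ m

  EvenPair : V → V → Set
  EvenPair u v = u ≢ v × StrongAnti u v
    × (∀ m (p : Fin (suc m) → V) → IsPath m p →
         p Fin.zero ≡ u → p (fromℕ m) ≡ v → Even m)

  CycCons : (k : ℕ) → Fin k → Fin k → Set
  CycCons k i j = toℕ j ≡ suc (toℕ i) ⊎ (suc (toℕ i) ≡ k × toℕ j ≡ 0)

  IsHole : (k : ℕ) → (Fin k → V) → Set
  IsHole k h = 5 ≤ k × Injective _≡_ _≡_ h
             × (∀ i j → CycCons k i j → Adj (h i) (h j))
             × (∀ i j → i ≢ j → ¬ CycCons k i j → ¬ CycCons k j i
                  → Antiadj (h i) (h j))

  OddHole : Set
  OddHole = Σ ℕ λ k → Σ (Fin k → V) λ h → IsHole k h × ¬ (2 ∣ k)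

complement : Trigraph → Trigraph
complement T = record
  { n = n T ; θ = λ u v → neg (θ T u v)
  ; symm = λ u v → Relation.Binary.PropositionalEquality.cong neg (symm T u v) }

OddAntihole : Trigraph → Set
OddAntihole T = OddHole (complement T)

Berge : Trigraph → Set
Berge T = ¬ OddHole T × ¬ OddAntihole T

module _ (T : Trigraph) where

  Sw : V T → V T → Set
  Sw u v = u ≢ v × θ T u v ≡ semi

  -- the possible shapes of Σ(T) for T ∈ 𝓕 : no switchable component,
  -- one component with one edge xy (small), one component with two
  -- edges vx, vy (light).
  data SwShape : Set where
    none  : (∀ u v → ¬ Sw u v) → SwShape
    small : (x y : V T) → Sw x y
          → (∀ u v → Sw u v → (u ≡ x × v ≡ y) ⊎ (u ≡ y × v ≡ x))
          → (∀ w → InN T x w → InN T y w → ⊥)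
          → SwShape
    light : (v x y : V T) → x ≢ y → Sw v x → Sw v y
          → (∀ a b → Sw a b → (a ≡ v × b ≡ x) ⊎ (a ≡ x × b ≡ v)
                              ⊎ (a ≡ v × b ≡ y) ⊎ (a ≡ y × b ≡ v))
          → (∀ w → w ≢ v → w ≢ x → w ≢ y → StrongAnti T v w)
          → StrongAnti T x y
          → (∀ w → InN T x w → InN T y w → w ≡ v)
          → SwShape

  InD : SwShape → V T → Set
  InD (none _) w = ⊥
  InD (small x y _ _ _) w = w ≡ x ⊎ w ≡ y
  InD (light v x y _ _ _ _ _ _ _) w = w ≡ v ⊎ w ≡ x ⊎ w ≡ y

  RestClique : SwShape → V T → Set
  RestClique s z = IsClique T (λ w → ¬ InD s w × ¬ InN T z w)

  SmallCond : SwShape → Set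
  SmallCond (none _) = Data.Unit.⊤
  SmallCond s@(small x y _ _ _) = ¬ RestClique s x ⊎ ¬ RestClique s y
  SmallCond (light _ _ _ _ _ _ _ _ _ _) = Data.Unit.⊤

  Favorable : SwShape → Set
  Favorable s = 5 ≤ n T
    × (Σ (V T) λ u → Σ (V T) λ v → u ≢ v × StrongAnti T u v × ¬ InD s u × ¬ InD s v)
    × SmallCond s

-- In a bipartite trigraph the two colour classes are strongly stable, so the
-- colours alternate along every path; hence two distinct vertices of the same
-- colour always form an even pair, and so does any antiadjacent pair ending in
-- a vertex without neighbours.  A strongly antiadjacent pair of distinct
-- colours therefore only fails to yield an even pair when there is no third
-- vertex to compare it with (two vertices in total), and in the favorable case
-- when there is no third vertex outside the switchable component.  Since
-- n ≥ 5, the latter can only happen for a light component {v, x, y} with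
-- exactly five vertices; then x and y share a colour, and whichever of the
-- given pair has that colour is strongly antiadjacent to everything else.
module Submission where

open import Defs
open import Data.Bool using (Bool)
open import Data.Bool.Properties using (¬-not)
open import Data.Fin using (Fin; zero; suc; toℕ; fromℕ; inject₁; _≟_)
open import Data.Fin.Properties using (toℕ-inject₁; all?; any?; ¬∀⟶∃¬; injective⇒≤)
open import Data.List using (List; []; _∷_; length; lookup)
open import Data.List.Membership.Propositional using (_∈_; _∉_)
open import Data.List.Relation.Unary.Any using (here; there; index)
open import Data.List.Relation.Unary.Any.Properties using (lookup-index)
open import Data.Nat using (ℕ; _≤_; _≤?_)
open import Data.Nat.Divisibility using (_∣_; _∣0; ∣-refl; ∣m∣n⇒∣m+n)
open import Data.Nat.Properties using (1+n≢n; ≤-trans)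
open import Data.Product using (Σ; ∃; ∃₂; _×_; _,_)
open import Data.Sum using (_⊎_; inj₁; inj₂)
open import Function using (_∘_)
open import Function.Definitions using (Injective)
open import Relation.Nullary using (¬_; Dec; yes; no; contradiction; ¬?; _×-dec_)
open import Relation.Nullary.Decidable using (from-no)
open import Relation.Binary.PropositionalEquality using (_≡_; _≢_; refl; sym; trans; cong; subst)

≢⇒≡⊎≡ : ∀ {x y z : Bool} → x ≢ y → z ≡ x ⊎ z ≡ y
≢⇒≡⊎≡ {x} {y} {z} x≢y with z Data.Bool.≟ x
... | yes z≡x = inj₁ z≡x
... | no z≢x = inj₂ (trans (¬-not z≢x) (sym (¬-not (x≢y ∘ sym))))

module _ {n : ℕ} where
  open import Data.List.Membership.DecPropositional (_≟_ {n}) using (_∈?_)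

  exhaustive⇒≤length : (xs : List (Fin n)) → (∀ w → w ∈ xs) → n ≤ length xs
  exhaustive⇒≤length xs exhaustive = injective⇒≤ position-injective
    where
    position-injective : Injective _≡_ _≡_ (index ∘ exhaustive)
    position-injective {w} {w′} eq =
      trans (lookup-index (exhaustive w))
            (trans (cong (lookup xs) eq) (sym (lookup-index (exhaustive w′))))

  fresh-or-exhaustive : (xs : List (Fin n)) → (∃ λ w → w ∉ xs) ⊎ (∀ w → w ∈ xs)
  fresh-or-exhaustive xs with all? (_∈? xs)
  ... | yes exhaustive = inj₂ exhaustive
  ... | no ¬exhaustive = inj₁ (¬∀⟶∃¬ n (_∈ xs) (_∈? xs) ¬exhaustive)

Alternating : ∀ {m} → (Fin (ℕ.suc m) → Bool) → Set
Alternating f = ∀ i → f (inject₁ i) ≢ f (suc i)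

alternating-closed⇒even : ∀ m (f : Fin (ℕ.suc m) → Bool) → Alternating f
                        → f (fromℕ m) ≡ f zero → 2 ∣ m
alternating-closed⇒even ℕ.zero f _ _ = 2 ∣0
alternating-closed⇒even (ℕ.suc ℕ.zero) f alternating closed =
  contradiction (sym closed) (alternating zero)
alternating-closed⇒even (ℕ.suc (ℕ.suc m)) f alternating closed =
  ∣m∣n⇒∣m+n ∣-refl
    (alternating-closed⇒even m (f ∘ suc ∘ suc) (alternating ∘ suc ∘ suc)
      (trans closed two-steps))
  where
  two-steps : f zero ≡ f (suc (suc zero))
  two-steps = trans (¬-not (alternating zero))
                    (sym (¬-not (alternating (suc zero) ∘ sym)))

¬anti⇒adj : ∀ {t} → t ≢ anti → t ≡ strong ⊎ t ≡ semi
¬anti⇒adj {anti} t≢anti = contradiction refl t≢anti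
¬anti⇒adj {semi} _ = inj₂ refl
¬anti⇒adj {strong} _ = inj₁ refl

anti? : (t : Val) → Dec (t ≡ anti)
anti? anti = yes refl
anti? semi = no λ ()
anti? strong = no λ ()

module _ (T : Trigraph) where

  adj⇒¬strongAnti : ∀ {u v} → Adj T u v → ¬ StrongAnti T u v
  adj⇒¬strongAnti (inj₁ strong≡) anti≡ = contradiction (trans (sym strong≡) anti≡) λ ()
  adj⇒¬strongAnti (inj₂ semi≡) anti≡ = contradiction (trans (sym semi≡) anti≡) λ ()

  path-step-adj : ∀ {m p} → IsPath T m p → ∀ i → Adj T (p (inject₁ i)) (p (suc i))
  path-step-adj (_ , adj , _) i = adj (inject₁ i) (suc i) (cong ℕ.suc (sym (toℕ-inject₁ i)))

  path-step-distinct : ∀ {m p} → IsPath T m p → ∀ i → p (inject₁ i) ≢ p (suc i)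
  path-step-distinct (injective , _) i eq =
    1+n≢n (sym (trans (sym (toℕ-inject₁ i)) (cong toℕ (injective eq))))

  Isolated : V T → Set
  Isolated v = ∀ w → w ≢ v → StrongAnti T w v

  isolated⇒evenPair : ∀ {u v} → u ≢ v → StrongAnti T u v → Isolated v → EvenPair T u v
  isolated⇒evenPair {u} {v} u≢v strongAnti isolated = u≢v , strongAnti , no-odd-path
    where
    no-odd-path : ∀ m p → IsPath T m p → p zero ≡ u → p (fromℕ m) ≡ v → Even T m
    no-odd-path ℕ.zero p _ p₀≡u p₀≡v = contradiction (trans (sym p₀≡u) p₀≡v) u≢v
    no-odd-path (ℕ.suc m) p path _ pₘ≡v =
      contradiction (isolated _ (subst (_ ≢_) pₘ≡v (path-step-distinct path (fromℕ m))))
                    (adj⇒¬strongAnti (subst (Adj T _) pₘ≡v (path-step-adj path (fromℕ m))))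

  complete-or-antiPair : Complete T ⊎ ∃₂ λ u v → u ≢ v × StrongAnti T u v
  complete-or-antiPair with any? (λ u → any? (λ v → ¬? (u ≟ v) ×-dec anti? (θ T u v)))
  ... | yes antiPair = inj₂ antiPair
  ... | no ¬antiPair = inj₁ λ u v u≢v → ¬anti⇒adj λ strongAnti → ¬antiPair (u , v , u≢v , strongAnti)

  members : SwShape T → List (V T)
  members (none _) = []
  members (small x y _ _ _) = x ∷ y ∷ []
  members (light v x y _ _ _ _ _ _ _) = v ∷ x ∷ y ∷ []

  inD⇒∈members : ∀ s {w} → InD T s w → w ∈ members s
  inD⇒∈members (small _ _ _ _ _) (inj₁ w≡x) = here w≡x
  inD⇒∈members (small _ _ _ _ _) (inj₂ w≡y) = there (here w≡y)
  inD⇒∈members (light _ _ _ _ _ _ _ _ _ _) (inj₁ w≡v) = here w≡v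
  inD⇒∈members (light _ _ _ _ _ _ _ _ _ _) (inj₂ (inj₁ w≡x)) = there (here w≡x)
  inD⇒∈members (light _ _ _ _ _ _ _ _ _ _) (inj₂ (inj₂ w≡y)) = there (there (here w≡y))

  ∈members⇒inD : ∀ s {w} → w ∈ members s → InD T s w
  ∈members⇒inD (small _ _ _ _ _) (here w≡x) = inj₁ w≡x
  ∈members⇒inD (small _ _ _ _ _) (there (here w≡y)) = inj₂ w≡y
  ∈members⇒inD (light _ _ _ _ _ _ _ _ _ _) (here w≡v) = inj₁ w≡v
  ∈members⇒inD (light _ _ _ _ _ _ _ _ _ _) (there (here w≡x)) = inj₂ (inj₁ w≡x)
  ∈members⇒inD (light _ _ _ _ _ _ _ _ _ _) (there (there (here w≡y))) = inj₂ (inj₂ w≡y)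

  EvenPairAvoiding : SwShape T → Set
  EvenPairAvoiding s = ∃₂ λ u v → EvenPair T u v × ¬ InD T s u × ¬ InD T s v

  module _ (c : V T → Bool) (proper : ∀ u v → u ≢ v → c u ≡ c v → StrongAnti T u v) where

    adj⇒colours-differ : ∀ {u v} → u ≢ v → Adj T u v → c u ≢ c v
    adj⇒colours-differ u≢v adj same = adj⇒¬strongAnti adj (proper _ _ u≢v same)

    path-alternates : ∀ {m p} → IsPath T m p → Alternating (c ∘ p)
    path-alternates path i =
      adj⇒colours-differ (path-step-distinct path i) (path-step-adj path i)

    same-colour⇒evenPair : ∀ {u v} → u ≢ v → c u ≡ c v → EvenPair T u v
    same-colour⇒evenPair {u} {v} u≢v same = u≢v , proper u v u≢v same , even
      where
      even : ∀ m p → IsPath T m p → p zero ≡ u → p (fromℕ m) ≡ v → Even T m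
      even m p path p₀≡u pₘ≡v = alternating-closed⇒even m (c ∘ p) (path-alternates path)
        (trans (cong c pₘ≡v) (trans (sym same) (sym (cong c p₀≡u))))

    third-vertex⇒evenPair : ∀ {u v w} → c u ≢ c v → w ≢ u → w ≢ v
                          → EvenPair T w u ⊎ EvenPair T w v
    third-vertex⇒evenPair colours-differ w≢u w≢v with ≢⇒≡⊎≡ colours-differ
    ... | inj₁ same = inj₁ (same-colour⇒evenPair w≢u same)
    ... | inj₂ same = inj₂ (same-colour⇒evenPair w≢v same)

    antiPair⇒evenPair : ∀ {u v} → u ≢ v → StrongAnti T u v → ∃₂ (EvenPair T)
    antiPair⇒evenPair {u} {v} u≢v strongAnti with c u Data.Bool.≟ c v
    ... | yes same = u , v , same-colour⇒evenPair u≢v same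
    ... | no differ with fresh-or-exhaustive (u ∷ v ∷ [])
    ...   | inj₁ (w , w∉) with third-vertex⇒evenPair differ (w∉ ∘ here) (w∉ ∘ there ∘ here)
    ...     | inj₁ evenPair = w , u , evenPair
    ...     | inj₂ evenPair = w , v , evenPair
    antiPair⇒evenPair {u} {v} u≢v strongAnti | no _ | inj₂ exhaustive =
      u , v , isolated⇒evenPair u≢v strongAnti isolated
      where
      isolated : Isolated v
      isolated w w≢v with exhaustive w
      ... | here refl = strongAnti
      ... | there (here w≡v) = contradiction w≡v w≢v

    complete-or-evenPair : Complete T ⊎ ∃₂ (EvenPair T)
    complete-or-evenPair with complete-or-antiPair
    ... | inj₁ complete = inj₁ complete
    ... | inj₂ (_ , _ , u≢v , strongAnti) = inj₂ (antiPair⇒evenPair u≢v strongAnti)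

    exhaustive⇒evenPairAvoiding : ∀ s {a b} → 5 ≤ n T → a ≢ b → StrongAnti T a b → c a ≢ c b
                                → ¬ InD T s a → ¬ InD T s b → (∀ w → w ∈ a ∷ b ∷ members s)
                                → EvenPairAvoiding s
    exhaustive⇒evenPairAvoiding (none _) 5≤n _ _ _ _ _ exhaustive =
      contradiction (≤-trans 5≤n (exhaustive⇒≤length _ exhaustive)) (from-no (5 ≤? 2))
    exhaustive⇒evenPairAvoiding (small _ _ _ _ _) 5≤n _ _ _ _ _ exhaustive =
      contradiction (≤-trans 5≤n (exhaustive⇒≤length _ exhaustive)) (from-no (5 ≤? 4))
    exhaustive⇒evenPairAvoiding s@(light v x y _ (v≢x , vx-semi) (v≢y , vy-semi) _ v-anti _ _)
      {a} {b} _ a≢b ab-anti differ a∉D b∉D exhaustive = choose (≢⇒≡⊎≡ differ)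
      where
      x~y : c x ≡ c y
      x~y = trans (¬-not (adj⇒colours-differ v≢x (inj₂ vx-semi) ∘ sym))
                  (sym (¬-not (adj⇒colours-differ v≢y (inj₂ vy-semi) ∘ sym)))

      D-antiadjacent : ∀ {b′ w} → ¬ InD T s b′ → c x ≡ c b′ → InD T s w → StrongAnti T w b′
      D-antiadjacent b′∉D _ (inj₁ refl) =
        v-anti _ (b′∉D ∘ inj₁) (b′∉D ∘ inj₂ ∘ inj₁) (b′∉D ∘ inj₂ ∘ inj₂)
      D-antiadjacent b′∉D x~b′ (inj₂ (inj₁ refl)) =
        proper x _ (b′∉D ∘ inj₂ ∘ inj₁ ∘ sym) x~b′
      D-antiadjacent b′∉D x~b′ (inj₂ (inj₂ refl)) =
        proper y _ (b′∉D ∘ inj₂ ∘ inj₂ ∘ sym) (trans (sym x~y) x~b′)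

      isolated : ∀ {b′} → ¬ InD T s b′ → c x ≡ c b′
               → (∀ w → w ≢ b′ → w ≡ a ⊎ w ≡ b → StrongAnti T w b′) → Isolated b′
      isolated b′∉D x~b′ antiadjacent-outside-D w w≢b′ with exhaustive w
      ... | here w≡a = antiadjacent-outside-D w w≢b′ (inj₁ w≡a)
      ... | there (here w≡b) = antiadjacent-outside-D w w≢b′ (inj₂ w≡b)
      ... | there (there w∈D) = D-antiadjacent b′∉D x~b′ (∈members⇒inD s w∈D)

      choose : c x ≡ c a ⊎ c x ≡ c b → EvenPairAvoiding s
      choose (inj₁ x~a) =
        b , a , isolated⇒evenPair (a≢b ∘ sym) (trans (symm T b a) ab-anti) a-isolated , b∉D , a∉D
        where
        a-isolated : Isolated a
        a-isolated = isolated a∉D x~a λ where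
          w w≢a (inj₁ w≡a) → contradiction w≡a w≢a
          _ _ (inj₂ refl) → trans (symm T b a) ab-anti
      choose (inj₂ x~b) =
        a , b , isolated⇒evenPair a≢b ab-anti b-isolated , a∉D , b∉D
        where
        b-isolated : Isolated b
        b-isolated = isolated b∉D x~b λ where
          _ _ (inj₁ refl) → ab-anti
          w w≢b (inj₂ w≡b) → contradiction w≡b w≢b

    favorable⇒evenPairAvoiding : ∀ s → Favorable T s → EvenPairAvoiding s
    favorable⇒evenPairAvoiding s (5≤n , (a , b , a≢b , ab-anti , a∉D , b∉D) , _)
      with c a Data.Bool.≟ c b
    ... | yes same = a , b , same-colour⇒evenPair a≢b same , a∉D , b∉D
    ... | no differ with fresh-or-exhaustive (a ∷ b ∷ members s)
    ...   | inj₂ exhaustive = exhaustive⇒evenPairAvoiding s 5≤n a≢b ab-anti differ a∉D b∉D exhaustive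
    ...   | inj₁ (w , w∉) with third-vertex⇒evenPair differ (w∉ ∘ here) (w∉ ∘ there ∘ here)
    ...     | inj₁ evenPair = w , a , evenPair , w∉ ∘ there ∘ there ∘ inD⇒∈members s , a∉D
    ...     | inj₂ evenPair = w , b , evenPair , w∉ ∘ there ∘ there ∘ inD⇒∈members s , b∉D

theorem4p2 : (T : Trigraph) → (s : SwShape T) → Berge T → Bipartite T
    → (Complete T ⊎ Σ (V T) (λ u → Σ (V T) (λ v → EvenPair T u v)))
      × (Favorable T s
         → Σ (V T) (λ u → Σ (V T) (λ v → EvenPair T u v × ¬ InD T s u × ¬ InD T s v)))
theorem4p2 T s _ (c , proper) =
  complete-or-evenPair T c proper , favorable⇒evenPairAvoiding T c proper s
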